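{- $\mathrm{GL}_3(\mathbb{F}_5)$ does not contain a subgroup isomorphic to $A_5\times V_4$.
   Context: $V_4$ denotes the Klein four-group $C_2\times C_2$. -}

module Defs where

open import Data.Nat using (ℕ; zero; suc; _<ᵇ_)
import Data.Nat as ℕ
open import Data.Nat.DivMod using (_mod_; _%_)
open import Data.Fin using (Fin; toℕ; fromℕ)
open import Data.Fin.Patterns using (0F; 1F; 2F)
open import Data.Vec using (Vec; lookup; tabulate)
open import Data.List using (List; map; concatMap; allFin)
open import Data.Nat.ListAction using (sum)
open import Data.Bool using (Bool; true; false; _∧_; _xor_; if_then_else_)
open import Data.Product using (Σ; _×_; _,_; proj₁; proj₂)
open import Relation.Binary.PropositionalEquality using (_≡_; _≢_)

F5 : Set
F5 = Fin 5

infixl 6 _+₅_ _-₅_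
infixl 7 _*₅_

_+₅_ : F5 → F5 → F5
a +₅ b = (toℕ a ℕ.+ toℕ b) mod 5

_*₅_ : F5 → F5 → F5
a *₅ b = (toℕ a ℕ.* toℕ b) mod 5

_-₅_ : F5 → F5 → F5
a -₅ b = (toℕ a ℕ.+ (5 ℕ.∸ toℕ b)) mod 5

zero₅ : F5
zero₅ = 0F

M3 : Set
M3 = Vec (Vec F5 3) 3

entry : M3 → Fin 3 → Fin 3 → F5
entry m i j = lookup (lookup m i) j

sum3 : (Fin 3 → F5) → F5
sum3 f = f 0F +₅ f 1F +₅ f 2F

_⊗_ : M3 → M3 → M3
m ⊗ n = tabulate λ i → tabulate λ j → sum3 λ k → entry m i k *₅ entry n k j

det : M3 → F5
det m =
      (a 0F 0F *₅ ((a 1F 1F *₅ a 2F 2F) -₅ (a 1F 2F *₅ a 2F 1F)))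
  -₅  (a 0F 1F *₅ ((a 1F 0F *₅ a 2F 2F) -₅ (a 1F 2F *₅ a 2F 0F)))
  +₅  (a 0F 2F *₅ ((a 1F 0F *₅ a 2F 1F) -₅ (a 1F 1F *₅ a 2F 0F)))
  where a = entry m

GL3F5 : Set
GL3F5 = Σ M3 λ m → det m ≢ zero₅

-- The alternating group A₅, as permutations of Fin 5 in one-line notation

Perm5 : Set
Perm5 = Vec (Fin 5) 5

IsPerm : Perm5 → Set
IsPerm v = ∀ i j → lookup v i ≡ lookup v j → i ≡ j

inversions : Perm5 → ℕ
inversions v = sum (concatMap (λ i → map (λ j →
  if (toℕ i <ᵇ toℕ j) ∧ (toℕ (lookup v j) <ᵇ toℕ (lookup v i)) then 1 else 0)
  (allFin 5)) (allFin 5))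

IsEven : Perm5 → Set
IsEven v = inversions v % 2 ≡ 0

A5 : Set
A5 = Σ Perm5 λ v → IsPerm v × IsEven v

_∘ₚ_ : Perm5 → Perm5 → Perm5
σ ∘ₚ τ = tabulate λ i → lookup σ (lookup τ i)

V4 : Set
V4 = Bool × Bool

_·V_ : V4 → V4 → V4
(a , b) ·V (c , d) = (a xor c , b xor d)

A5×V4 : Set
A5×V4 = A5 × V4

⌊_⌋ : A5×V4 → Perm5 × V4
⌊ (σ , _) , v ⌋ = σ , v

_·_ : Perm5 × V4 → Perm5 × V4 → Perm5 × V4
(σ , a) · (τ , b) = (σ ∘ₚ τ , a ·V b)

IsEmbedding : (A5×V4 → GL3F5) → Set
IsEmbedding φ =
    (∀ x y z → ⌊ z ⌋ ≡ ⌊ x ⌋ · ⌊ y ⌋ → proj₁ (φ z) ≡ proj₁ (φ x) ⊗ proj₁ (φ y))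
  × (∀ x y → proj₁ (φ x) ≡ proj₁ (φ y) → ⌊ x ⌋ ≡ ⌊ y ⌋)

module Submission where

open import Defs
open import Data.Product using (Σ)
open import Relation.Nullary using (¬_)

open import Algebra.Bundles using (CommutativeSemiring; CommutativeSemigroup)
open import Algebra.Structures using (IsCommutativeMonoid)
open import Algebra.Structures.Biased using (isCommutativeMonoidˡ; isCommutativeSemiringˡ)
import Data.Bool as Bool
open import Data.Bool using (Bool; true; false; _xor_; _∧_)
open import Data.Bool.Properties using (xor-identityʳ; xor-same; ∧-comm; xor-∧-commutativeRing)
open import Data.Empty using (⊥-elim)
open import Data.Fin using (Fin; zero; suc; _≟_; combine; funToFin; finToFun)
open import Data.Fin.Patterns using (0F; 1F; 2F; 3F; 4F)
open import Data.Fin.Properties using (all?; any?; injective⇒≤; funToFin-finToFin; finToFun-funToFin)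
open import Data.List using (List; []; _∷_; length)
import Data.List as List
open import Data.List.Properties using (length-map)
open import Data.List.Relation.Unary.All using (All; []; _∷_)
import Data.List.Relation.Unary.All as All
import Data.List.Relation.Unary.All.Properties as All
open import Data.List.Relation.Unary.AllPairs using (AllPairs; []; _∷_)
import Data.Nat as ℕ
open import Data.Nat using (ℕ; zero; suc; _^_; _≤_; s≤s)
open import Data.Nat.DivMod using (_%_)
open import Data.Nat.Properties using (≤-refl; m≤n⇒m≤1+n)
open import Data.Product using (_×_; _,_; proj₁; proj₂; ∃)
import Data.Product.Properties as Product
open import Data.Sum using (inj₁; inj₂; [_,_]′)
open import Data.Vec using (Vec; []; _∷_; lookup; map; zipWith; replicate; tabulate)
open import Data.Vec.Properties
  using (≡-dec; ∷-injectiveˡ; ∷-injectiveʳ; lookup∘tabulate; tabulate∘lookup; tabulate-cong;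
         zipWith-assoc; zipWith-comm; zipWith-identityˡ; zipWith-identityʳ)
open import Function using (_∘_)
open import Function.Definitions using (Injective)
open import Relation.Binary.PropositionalEquality
open import Relation.Binary.PropositionalEquality.Algebra using (isMagma)
open import Relation.Nullary using (Dec; yes; no)
open import Relation.Nullary.Decidable
  using (from-yes; from-no; dec⇒maybe; map′; decidable-stable; ¬?; _→-dec_; _×-dec_; _⊎-dec_)
open import Tactic.RingSolver using (solve-∀)
open import Tactic.RingSolver.Core.AlmostCommutativeRing
  using (AlmostCommutativeRing; fromCommutativeSemiring; fromCommutativeRing)

-- Restricted to the subgroup V₄ × V₄ of A₅ × V₄, an embedding would be a faithful representation ρ
-- of the elementary abelian group 𝔽₂⁴ on 𝔽₅³. As 2 is invertible in 𝔽₅, 𝔽₅³ is the sum of the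
-- images of the operators π χ = Σₓ χ(x) ρ(x), one for each character χ of 𝔽₂⁴, and π χ maps into
-- the χ-eigenspace. Faithfulness means every y ≠ 0 is detected by some character χ (χ(y) = −1) with
-- nonzero eigenspace. Since any three characters have a common nonzero zero y, four distinct
-- characters with eigenvectors can be found one after the other; eigenvectors for distinct
-- characters are linearly independent, so 𝔽₅⁴ would embed into 𝔽₅³, which is impossible by counting.

private
  variable
    m n : ℕ

+₅-assoc : ∀ a b c → (a +₅ b) +₅ c ≡ a +₅ (b +₅ c)
+₅-assoc = from-yes (all? λ a → all? λ b → all? λ c → (a +₅ b) +₅ c ≟ a +₅ (b +₅ c))

+₅-comm : ∀ a b → a +₅ b ≡ b +₅ a
+₅-comm = from-yes (all? λ a → all? λ b → a +₅ b ≟ b +₅ a)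

+₅-identityˡ : ∀ a → 0F +₅ a ≡ a
+₅-identityˡ = from-yes (all? λ a → 0F +₅ a ≟ a)

+₅-identityʳ : ∀ a → a +₅ 0F ≡ a
+₅-identityʳ = from-yes (all? λ a → a +₅ 0F ≟ a)

+₅-cancelˡ : ∀ a b c → a +₅ b ≡ a +₅ c → b ≡ c
+₅-cancelˡ = from-yes (all? λ a → all? λ b → all? λ c → (a +₅ b ≟ a +₅ c) →-dec (b ≟ c))

*₅-assoc : ∀ a b c → (a *₅ b) *₅ c ≡ a *₅ (b *₅ c)
*₅-assoc = from-yes (all? λ a → all? λ b → all? λ c → (a *₅ b) *₅ c ≟ a *₅ (b *₅ c))

*₅-comm : ∀ a b → a *₅ b ≡ b *₅ a
*₅-comm = from-yes (all? λ a → all? λ b → a *₅ b ≟ b *₅ a)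

*₅-identityˡ : ∀ a → 1F *₅ a ≡ a
*₅-identityˡ = from-yes (all? λ a → 1F *₅ a ≟ a)

*₅-identityʳ : ∀ a → a *₅ 1F ≡ a
*₅-identityʳ = from-yes (all? λ a → a *₅ 1F ≟ a)

*₅-zeroˡ : ∀ a → 0F *₅ a ≡ 0F
*₅-zeroˡ = from-yes (all? λ a → 0F *₅ a ≟ 0F)

*₅-zeroʳ : ∀ a → a *₅ 0F ≡ 0F
*₅-zeroʳ = from-yes (all? λ a → a *₅ 0F ≟ 0F)

*₅-distribˡ : ∀ a b c → a *₅ (b +₅ c) ≡ a *₅ b +₅ a *₅ c
*₅-distribˡ = from-yes (all? λ a → all? λ b → all? λ c → a *₅ (b +₅ c) ≟ a *₅ b +₅ a *₅ c)

*₅-distribʳ : ∀ a b c → (b +₅ c) *₅ a ≡ b *₅ a +₅ c *₅ a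
*₅-distribʳ = from-yes (all? λ a → all? λ b → all? λ c → (b +₅ c) *₅ a ≟ b *₅ a +₅ c *₅ a)

*₅-cancelʳ-≢0 : ∀ p a b → p ≢ 0F → a *₅ p ≡ b *₅ p → a ≡ b
*₅-cancelʳ-≢0 = from-yes (all? λ p → all? λ a → all? λ b →
  ¬? (p ≟ 0F) →-dec (a *₅ p ≟ b *₅ p) →-dec (a ≟ b))

≡-isCommutativeMonoid : ∀ {A : Set} (_∙_ : A → A → A) (ε : A) →
  (∀ a b c → (a ∙ b) ∙ c ≡ a ∙ (b ∙ c)) → (∀ a → ε ∙ a ≡ a) → (∀ a b → a ∙ b ≡ b ∙ a) →
  IsCommutativeMonoid _≡_ _∙_ ε
≡-isCommutativeMonoid _∙_ ε assoc identityˡ comm = isCommutativeMonoidˡ record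
  { isSemigroup = record { isMagma = isMagma _∙_ ; assoc = assoc }
  ; identityˡ = identityˡ
  ; comm = comm
  }

F₅-commutativeSemiring : CommutativeSemiring _ _
F₅-commutativeSemiring = record { isCommutativeSemiring = isCommutativeSemiringˡ record
  { +-isCommutativeMonoid = ≡-isCommutativeMonoid _+₅_ 0F +₅-assoc +₅-identityˡ +₅-comm
  ; *-isCommutativeMonoid = ≡-isCommutativeMonoid _*₅_ 1F *₅-assoc *₅-identityˡ *₅-comm
  ; distribʳ = *₅-distribʳ
  ; zeroˡ = *₅-zeroˡ
  } }

F₅-ring : AlmostCommutativeRing _ _
F₅-ring = fromCommutativeSemiring F₅-commutativeSemiring (λ x → dec⇒maybe (0F ≟ x))

infixl 6 _+ᵥ_
infixr 7 _·ᵥ_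

_+ᵥ_ : Vec F5 n → Vec F5 n → Vec F5 n
_+ᵥ_ = zipWith _+₅_

_·ᵥ_ : F5 → Vec F5 n → Vec F5 n
k ·ᵥ v = map (k *₅_) v

0ᵥ : Vec F5 n
0ᵥ = replicate _ 0F

+ᵥ-assoc : ∀ (u v w : Vec F5 n) → (u +ᵥ v) +ᵥ w ≡ u +ᵥ (v +ᵥ w)
+ᵥ-assoc = zipWith-assoc +₅-assoc

+ᵥ-comm : ∀ (v w : Vec F5 n) → v +ᵥ w ≡ w +ᵥ v
+ᵥ-comm = zipWith-comm +₅-comm

+ᵥ-identityˡ : ∀ (v : Vec F5 n) → 0ᵥ +ᵥ v ≡ v
+ᵥ-identityˡ = zipWith-identityˡ +₅-identityˡ

+ᵥ-identityʳ : ∀ (v : Vec F5 n) → v +ᵥ 0ᵥ ≡ v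
+ᵥ-identityʳ = zipWith-identityʳ +₅-identityʳ

+ᵥ-cancelˡ : ∀ (u v w : Vec F5 n) → u +ᵥ v ≡ u +ᵥ w → v ≡ w
+ᵥ-cancelˡ [] [] [] _ = refl
+ᵥ-cancelˡ (a ∷ u) (b ∷ v) (c ∷ w) eq =
  cong₂ _∷_ (+₅-cancelˡ a b c (∷-injectiveˡ eq)) (+ᵥ-cancelˡ u v w (∷-injectiveʳ eq))

·ᵥ-distribˡ : ∀ k (v w : Vec F5 n) → k ·ᵥ (v +ᵥ w) ≡ k ·ᵥ v +ᵥ k ·ᵥ w
·ᵥ-distribˡ k [] [] = refl
·ᵥ-distribˡ k (a ∷ v) (b ∷ w) = cong₂ _∷_ (*₅-distribˡ k a b) (·ᵥ-distribˡ k v w)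

·ᵥ-distribʳ : ∀ k l (v : Vec F5 n) → (k +₅ l) ·ᵥ v ≡ k ·ᵥ v +ᵥ l ·ᵥ v
·ᵥ-distribʳ k l [] = refl
·ᵥ-distribʳ k l (a ∷ v) = cong₂ _∷_ (*₅-distribʳ a k l) (·ᵥ-distribʳ k l v)

·ᵥ-assoc : ∀ k l (v : Vec F5 n) → (k *₅ l) ·ᵥ v ≡ k ·ᵥ l ·ᵥ v
·ᵥ-assoc k l [] = refl
·ᵥ-assoc k l (a ∷ v) = cong₂ _∷_ (*₅-assoc k l a) (·ᵥ-assoc k l v)

·ᵥ-comm : ∀ k l (v : Vec F5 n) → k ·ᵥ l ·ᵥ v ≡ l ·ᵥ k ·ᵥ v
·ᵥ-comm k l v = trans (sym (·ᵥ-assoc k l v)) (trans (cong (_·ᵥ v) (*₅-comm k l)) (·ᵥ-assoc l k v))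

·ᵥ-identityˡ : ∀ (v : Vec F5 n) → 1F ·ᵥ v ≡ v
·ᵥ-identityˡ [] = refl
·ᵥ-identityˡ (a ∷ v) = cong₂ _∷_ (*₅-identityˡ a) (·ᵥ-identityˡ v)

·ᵥ-zeroˡ : ∀ (v : Vec F5 n) → 0F ·ᵥ v ≡ 0ᵥ
·ᵥ-zeroˡ [] = refl
·ᵥ-zeroˡ (a ∷ v) = cong₂ _∷_ (*₅-zeroˡ a) (·ᵥ-zeroˡ v)

·ᵥ-zeroʳ : ∀ k → k ·ᵥ 0ᵥ ≡ 0ᵥ {n}
·ᵥ-zeroʳ {zero} k = refl
·ᵥ-zeroʳ {suc n} k = cong₂ _∷_ (*₅-zeroʳ k) (·ᵥ-zeroʳ k)

·ᵥ-cancelʳ : ∀ a b (v : Vec F5 n) → v ≢ 0ᵥ → a ·ᵥ v ≡ b ·ᵥ v → a ≡ b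
·ᵥ-cancelʳ a b [] v≢0 _ = ⊥-elim (v≢0 refl)
·ᵥ-cancelʳ a b (x ∷ v) v≢0 eq with x ≟ 0F
... | yes refl = ·ᵥ-cancelʳ a b v (v≢0 ∘ cong (0F ∷_)) (∷-injectiveʳ eq)
... | no x≢0 = *₅-cancelʳ-≢0 x a b x≢0 (∷-injectiveˡ eq)

+ᵥ-isCommutativeMonoid : IsCommutativeMonoid _≡_ (_+ᵥ_ {n}) 0ᵥ
+ᵥ-isCommutativeMonoid = ≡-isCommutativeMonoid _+ᵥ_ 0ᵥ +ᵥ-assoc +ᵥ-identityˡ +ᵥ-comm

_≟ᵥ_ : (u v : Vec F5 n) → Dec (u ≡ v)
_≟ᵥ_ = ≡-dec _≟_

infix 8 _⋅_
infixr 7 _·ₘ_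

_⋅_ : Vec F5 n → Vec F5 n → F5
[] ⋅ [] = 0F
(a ∷ r) ⋅ (x ∷ v) = a *₅ x +₅ r ⋅ v

_·ₘ_ : Vec (Vec F5 n) m → Vec F5 n → Vec F5 m
A ·ₘ v = map (_⋅ v) A

⋅-+ᵥ : ∀ (r v w : Vec F5 n) → r ⋅ (v +ᵥ w) ≡ r ⋅ v +₅ r ⋅ w
⋅-+ᵥ [] [] [] = refl
⋅-+ᵥ (a ∷ r) (x ∷ v) (y ∷ w) = trans (cong (a *₅ (x +₅ y) +₅_) (⋅-+ᵥ r v w)) (step a x y (r ⋅ v) (r ⋅ w))
  where
  step : ∀ a x y s t → a *₅ (x +₅ y) +₅ (s +₅ t) ≡ (a *₅ x +₅ s) +₅ (a *₅ y +₅ t)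
  step = solve-∀ F₅-ring

⋅-·ᵥ : ∀ k (r v : Vec F5 n) → r ⋅ (k ·ᵥ v) ≡ k *₅ r ⋅ v
⋅-·ᵥ k [] [] = sym (*₅-zeroʳ k)
⋅-·ᵥ k (a ∷ r) (x ∷ v) = trans (cong (a *₅ (k *₅ x) +₅_) (⋅-·ᵥ k r v)) (step k a x (r ⋅ v))
  where
  step : ∀ k a x s → a *₅ (k *₅ x) +₅ k *₅ s ≡ k *₅ (a *₅ x +₅ s)
  step = solve-∀ F₅-ring

·ₘ-+ᵥ : ∀ (A : Vec (Vec F5 n) m) v w → A ·ₘ (v +ᵥ w) ≡ A ·ₘ v +ᵥ A ·ₘ w
·ₘ-+ᵥ [] v w = refl
·ₘ-+ᵥ (r ∷ A) v w = cong₂ _∷_ (⋅-+ᵥ r v w) (·ₘ-+ᵥ A v w)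

·ₘ-·ᵥ : ∀ (A : Vec (Vec F5 n) m) k v → A ·ₘ (k ·ᵥ v) ≡ k ·ᵥ A ·ₘ v
·ₘ-·ᵥ [] k v = refl
·ₘ-·ᵥ (r ∷ A) k v = cong₂ _∷_ (⋅-·ᵥ k r v) (·ₘ-·ᵥ A k v)

⊗-·ₘ : ∀ (A B : M3) v → (A ⊗ B) ·ₘ v ≡ A ·ₘ B ·ₘ v
-- Once all entries are variables, both sides of `row r` compute to the two sides of row-lemma.
⊗-·ₘ (r₀ ∷ r₁ ∷ r₂ ∷ []) B@((b₀₀ ∷ b₀₁ ∷ b₀₂ ∷ []) ∷ (b₁₀ ∷ b₁₁ ∷ b₁₂ ∷ []) ∷ (b₂₀ ∷ b₂₁ ∷ b₂₂ ∷ []) ∷ [])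
     v@(x ∷ y ∷ z ∷ []) = cong₂ _∷_ (row r₀) (cong₂ _∷_ (row r₁) (cong₂ _∷_ (row r₂) refl))
  where
  row-lemma : ∀ a₀ a₁ a₂ b₀₀ b₀₁ b₀₂ b₁₀ b₁₁ b₁₂ b₂₀ b₂₁ b₂₂ x y z →
      (a₀ *₅ b₀₀ +₅ a₁ *₅ b₁₀ +₅ a₂ *₅ b₂₀) *₅ x +₅ ((a₀ *₅ b₀₁ +₅ a₁ *₅ b₁₁ +₅ a₂ *₅ b₂₁) *₅ y
        +₅ ((a₀ *₅ b₀₂ +₅ a₁ *₅ b₁₂ +₅ a₂ *₅ b₂₂) *₅ z +₅ 0F))
    ≡ a₀ *₅ (b₀₀ *₅ x +₅ (b₀₁ *₅ y +₅ (b₀₂ *₅ z +₅ 0F)))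
        +₅ (a₁ *₅ (b₁₀ *₅ x +₅ (b₁₁ *₅ y +₅ (b₁₂ *₅ z +₅ 0F)))
        +₅ (a₂ *₅ (b₂₀ *₅ x +₅ (b₂₁ *₅ y +₅ (b₂₂ *₅ z +₅ 0F))) +₅ 0F))
  row-lemma = solve-∀ F₅-ring
  row : ∀ r → tabulate (λ j → sum3 λ k → lookup r k *₅ entry B k j) ⋅ v ≡ r ⋅ (B ·ₘ v)
  row (a₀ ∷ a₁ ∷ a₂ ∷ []) = row-lemma a₀ a₁ a₂ b₀₀ b₀₁ b₀₂ b₁₀ b₁₁ b₁₂ b₂₀ b₂₁ b₂₂ x y z

basis : Fin n → Vec F5 n
basis zero = 1F ∷ 0ᵥ
basis (suc k) = 0F ∷ basis k

⋅-zeroʳ : ∀ (r : Vec F5 n) → r ⋅ 0ᵥ ≡ 0F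
⋅-zeroʳ [] = refl
⋅-zeroʳ (a ∷ r) = trans (cong₂ _+₅_ (*₅-zeroʳ a) (⋅-zeroʳ r)) (+₅-identityˡ 0F)

⋅-basis : ∀ (r : Vec F5 n) k → r ⋅ basis k ≡ lookup r k
⋅-basis (a ∷ r) zero = trans (cong₂ _+₅_ (*₅-identityʳ a) (⋅-zeroʳ r)) (+₅-identityʳ a)
⋅-basis (a ∷ r) (suc k) = trans (cong₂ _+₅_ (*₅-zeroʳ a) (⋅-basis r k)) (+₅-identityˡ (lookup r k))

lookup-extensionality : ∀ {A : Set} (u v : Vec A n) → (∀ i → lookup u i ≡ lookup v i) → u ≡ v
lookup-extensionality u v eq = trans (sym (tabulate∘lookup u)) (trans (tabulate-cong eq) (tabulate∘lookup v))

·ₘ-basis-injective : ∀ (A B : Vec (Vec F5 n) m) → (∀ k → A ·ₘ basis k ≡ B ·ₘ basis k) → A ≡ B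
·ₘ-basis-injective [] [] _ = refl
·ₘ-basis-injective (r ∷ A) (s ∷ B) eq = cong₂ _∷_
  (lookup-extensionality r s λ k → trans (sym (⋅-basis r k)) (trans (∷-injectiveˡ (eq k)) (⋅-basis s k)))
  (·ₘ-basis-injective A B (∷-injectiveʳ ∘ eq))

funToFin-cong : ∀ {k} {f g : Fin m → Fin k} → (∀ i → f i ≡ g i) → funToFin f ≡ funToFin g
funToFin-cong {zero} _ = refl
funToFin-cong {suc m} eq = cong₂ combine (eq zero) (funToFin-cong (eq ∘ suc))

vec-injection⇒^≤ : ∀ {k} {F : Vec (Fin k) m → Vec (Fin k) n} → Injective _≡_ _≡_ F → k ^ m ≤ k ^ n
vec-injection⇒^≤ {m} {n} {k} {F} F-injective =
  injective⇒≤ {f = encode ∘ F ∘ decode} (decode-injective ∘ F-injective ∘ encode-injective)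
  where
  encode : Vec (Fin k) n → Fin (k ^ n)
  encode v = funToFin (lookup v)

  decode : Fin (k ^ m) → Vec (Fin k) m
  decode i = tabulate (finToFun i)

  encode-injective : Injective _≡_ _≡_ encode
  encode-injective {u} {v} eq = lookup-extensionality u v λ i → begin
    lookup u i                          ≡⟨ finToFun-funToFin (lookup u) i ⟨
    finToFun (funToFin (lookup u)) i    ≡⟨ cong (λ j → finToFun j i) eq ⟩
    finToFun (funToFin (lookup v)) i    ≡⟨ finToFun-funToFin (lookup v) i ⟩
    lookup v i                          ∎
    where open ≡-Reasoning

  decode-injective : Injective _≡_ _≡_ decode
  decode-injective {i} {j} eq = begin
    i                                   ≡⟨ funToFin-finToFin {m} {k} i ⟨
    funToFin (finToFun {k} {m} i)       ≡⟨ funToFin-cong {m = m} {k = k} (lookup∘tabulate (finToFun i)) ⟨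
    funToFin (lookup (decode i))        ≡⟨ cong (funToFin ∘ lookup) eq ⟩
    funToFin (lookup (decode j))        ≡⟨ funToFin-cong {m = m} {k = k} (lookup∘tabulate (finToFun j)) ⟩
    funToFin (finToFun {k} {m} j)       ≡⟨ funToFin-finToFin {m} {k} j ⟩
    j                                   ∎
    where open ≡-Reasoning

-- The group 𝔽₂ⁿ and its characters

infixl 6 _⊕_
infix 7 _⊙_

𝔽₂-ring : AlmostCommutativeRing _ _
𝔽₂-ring = fromCommutativeRing xor-∧-commutativeRing (λ x → dec⇒maybe (false Bool.≟ x))

_⊕_ : Vec Bool n → Vec Bool n → Vec Bool n
_⊕_ = zipWith _xor_

0ᵇ : Vec Bool n
0ᵇ = replicate _ false

_⊙_ : Vec Bool n → Vec Bool n → Bool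
[] ⊙ [] = false
(a ∷ χ) ⊙ (b ∷ x) = (a ∧ b) xor χ ⊙ x

⊕-identityʳ : ∀ (x : Vec Bool n) → x ⊕ 0ᵇ ≡ x
⊕-identityʳ = zipWith-identityʳ xor-identityʳ

⊕-self : ∀ (x : Vec Bool n) → x ⊕ x ≡ 0ᵇ
⊕-self [] = refl
⊕-self (a ∷ x) = cong₂ _∷_ (xor-same a) (⊕-self x)

⊕-cancel : ∀ (x y : Vec Bool n) → y ⊕ (x ⊕ y) ≡ x
⊕-cancel [] [] = refl
⊕-cancel (a ∷ x) (b ∷ y) = cong₂ _∷_ (xor-cancel a b) (⊕-cancel x y)
  where
  xor-cancel : ∀ a b → b xor (a xor b) ≡ a
  xor-cancel false false = refl
  xor-cancel false true = refl
  xor-cancel true false = refl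
  xor-cancel true true = refl

⊕≡0⇒≡ : ∀ (x y : Vec Bool n) → x ⊕ y ≡ 0ᵇ → x ≡ y
⊕≡0⇒≡ [] [] _ = refl
⊕≡0⇒≡ (a ∷ x) (b ∷ y) eq = cong₂ _∷_ (xor≡false a b (∷-injectiveˡ eq)) (⊕≡0⇒≡ x y (∷-injectiveʳ eq))
  where
  xor≡false : ∀ a b → a xor b ≡ false → a ≡ b
  xor≡false false false _ = refl
  xor≡false true true _ = refl

⊙-comm : ∀ (χ x : Vec Bool n) → χ ⊙ x ≡ x ⊙ χ
⊙-comm [] [] = refl
⊙-comm (a ∷ χ) (b ∷ x) = cong₂ _xor_ (∧-comm a b) (⊙-comm χ x)

⊙-⊕ʳ : ∀ (χ x y : Vec Bool n) → χ ⊙ (x ⊕ y) ≡ χ ⊙ x xor χ ⊙ y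
⊙-⊕ʳ [] [] [] = refl
⊙-⊕ʳ (a ∷ χ) (b ∷ x) (c ∷ y) = trans (cong ((a ∧ (b xor c)) xor_) (⊙-⊕ʳ χ x y)) (step a b c (χ ⊙ x) (χ ⊙ y))
  where
  step : ∀ a b c s t → (a ∧ (b xor c)) xor (s xor t) ≡ ((a ∧ b) xor s) xor ((a ∧ c) xor t)
  step = solve-∀ 𝔽₂-ring

∃-Bool? : {P : Bool → Set} → (∀ b → Dec (P b)) → Dec (∃ P)
∃-Bool? P? = map′ [ (false ,_) , (true ,_) ]′ (λ { (false , p) → inj₁ p ; (true , p) → inj₂ p })
  (P? false ⊎-dec P? true)

∃ᵇ? : {P : Vec Bool n → Set} → (∀ x → Dec (P x)) → Dec (∃ P)
∃ᵇ? {zero} P? = map′ ([] ,_) (λ { ([] , p) → p }) (P? [])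
∃ᵇ? {suc n} P? = map′ (λ (b , x , p) → b ∷ x , p) (λ { (b ∷ x , p) → b , x , p })
  (∃-Bool? λ b → ∃ᵇ? λ x → P? (b ∷ x))

∀ᵇ? : {P : Vec Bool n → Set} → (∀ x → Dec (P x)) → Dec (∀ x → P x)
∀ᵇ? P? = map′ (λ ∄¬P x → decidable-stable (P? x) (∄¬P ∘ (x ,_))) (λ ∀P (x , ¬p) → ¬p (∀P x))
  (¬? (∃ᵇ? (¬? ∘ P?)))

_≟ᵇ_ : (x y : Vec Bool n) → Dec (x ≡ y)
_≟ᵇ_ = ≡-dec Bool._≟_

three-characters-common-kernel : ∀ (χ₁ χ₂ χ₃ : Vec Bool 4) →
  ∃ λ y → y ≢ 0ᵇ × χ₁ ⊙ y ≡ false × χ₂ ⊙ y ≡ false × χ₃ ⊙ y ≡ false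
three-characters-common-kernel = from-yes (∀ᵇ? {4} λ χ₁ → ∀ᵇ? {4} λ χ₂ → ∀ᵇ? {4} λ χ₃ → ∃ᵇ? {4} λ y →
  ¬? (y ≟ᵇ 0ᵇ) ×-dec (χ₁ ⊙ y Bool.≟ false) ×-dec (χ₂ ⊙ y Bool.≟ false) ×-dec (χ₃ ⊙ y Bool.≟ false))

common-kernel : (χs : List (Vec Bool 4)) → length χs ≤ 3 →
                ∃ λ y → y ≢ 0ᵇ × All (λ χ → χ ⊙ y ≡ false) χs
common-kernel [] _ =
  let y , y≢0 , _ = three-characters-common-kernel 0ᵇ 0ᵇ 0ᵇ in y , y≢0 , []
common-kernel (a ∷ []) _ =
  let y , y≢0 , a⊥y , _ = three-characters-common-kernel a a a in y , y≢0 , a⊥y ∷ []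
common-kernel (a ∷ b ∷ []) _ =
  let y , y≢0 , a⊥y , b⊥y , _ = three-characters-common-kernel a b b in y , y≢0 , a⊥y ∷ b⊥y ∷ []
common-kernel (a ∷ b ∷ c ∷ []) _ =
  let y , y≢0 , a⊥y , b⊥y , c⊥y = three-characters-common-kernel a b c in y , y≢0 , a⊥y ∷ b⊥y ∷ c⊥y ∷ []
common-kernel (_ ∷ _ ∷ _ ∷ _ ∷ _) (s≤s (s≤s (s≤s ())))

sign : Bool → F5
sign false = 1F
sign true = 4F

sign-xor : ∀ a b → sign (a xor b) ≡ sign a *₅ sign b
sign-xor false false = refl
sign-xor false true = refl
sign-xor true false = refl
sign-xor true true = refl

char : Vec Bool n → Vec Bool n → F5
char χ x = sign (χ ⊙ x)

char-⊕ʳ : ∀ (χ x y : Vec Bool n) → char χ (x ⊕ y) ≡ char χ x *₅ char χ y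
char-⊕ʳ χ x y = trans (cong sign (⊙-⊕ʳ χ x y)) (sign-xor (χ ⊙ x) (χ ⊙ y))

char-⊕ˡ : ∀ (χ ψ x : Vec Bool n) → char (χ ⊕ ψ) x ≡ char χ x *₅ char ψ x
char-⊕ˡ χ ψ x = begin
  sign ((χ ⊕ ψ) ⊙ x)      ≡⟨ cong sign (⊙-comm (χ ⊕ ψ) x) ⟩
  sign (x ⊙ (χ ⊕ ψ))      ≡⟨ char-⊕ʳ x χ ψ ⟩
  char x χ *₅ char x ψ    ≡⟨ cong₂ (λ a b → sign a *₅ sign b) (⊙-comm x χ) (⊙-comm x ψ) ⟩
  char χ x *₅ char ψ x    ∎
  where open ≡-Reasoning

char-·ᵥ-undetected : ∀ (χ y : Vec Bool n) (v : Vec F5 m) → (χ ⊙ y ≡ true → v ≡ 0ᵥ) → char χ y ·ᵥ v ≡ v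
char-·ᵥ-undetected χ y v vanish with χ ⊙ y
... | false = ·ᵥ-identityˡ v
... | true rewrite vanish refl = ·ᵥ-zeroʳ 4F

δ : Vec Bool n → F5
δ [] = 1F
δ (false ∷ x) = δ x
δ (true ∷ x) = 0F

δ-zero : δ (0ᵇ {n}) ≡ 1F
δ-zero {zero} = refl
δ-zero {suc n} = δ-zero {n}

δ-nonzero : ∀ (x : Vec Bool n) → x ≢ 0ᵇ → δ x ≡ 0F
δ-nonzero [] x≢0 = ⊥-elim (x≢0 refl)
δ-nonzero (false ∷ x) x≢0 = δ-nonzero x (x≢0 ∘ cong (false ∷_))
δ-nonzero (true ∷ x) _ = refl

∑ : {A : Set} → (A → A → A) → (Vec Bool n → A) → A
∑ {zero} _∙_ f = f []
∑ {suc n} _∙_ f = ∑ _∙_ (λ x → f (false ∷ x)) ∙ ∑ _∙_ (λ x → f (true ∷ x))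

∑-cong : ∀ {A : Set} (_∙_ : A → A → A) {f g : Vec Bool n → A} → (∀ x → f x ≡ g x) → ∑ _∙_ f ≡ ∑ _∙_ g
∑-cong {zero} _∙_ eq = eq []
∑-cong {suc n} _∙_ eq = cong₂ _∙_ (∑-cong _∙_ (eq ∘ (false ∷_))) (∑-cong _∙_ (eq ∘ (true ∷_)))

∑-hom : ∀ {A B : Set} (_∙_ : A → A → A) (_◇_ : B → B → B) (h : A → B) →
        (∀ a b → h (a ∙ b) ≡ h a ◇ h b) → (f : Vec Bool n → A) → h (∑ _∙_ f) ≡ ∑ _◇_ (h ∘ f)
∑-hom {zero} _∙_ _◇_ h hom f = refl
∑-hom {suc n} _∙_ _◇_ h hom f = trans (hom _ _)
  (cong₂ _◇_ (∑-hom _∙_ _◇_ h hom (f ∘ (false ∷_))) (∑-hom _∙_ _◇_ h hom (f ∘ (true ∷_))))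

module Sum {A : Set} {_∙_ : A → A → A} {ε : A} (isCommutativeMonoid : IsCommutativeMonoid _≡_ _∙_ ε) where

  open IsCommutativeMonoid isCommutativeMonoid using (identityˡ; identityʳ; comm; isCommutativeSemigroup)

  commutativeSemigroup : CommutativeSemigroup _ _
  commutativeSemigroup = record { isCommutativeSemigroup = isCommutativeSemigroup }

  open import Algebra.Properties.CommutativeSemigroup commutativeSemigroup using (interchange)

  ∑-ε : ∀ (f : Vec Bool n → A) → (∀ x → f x ≡ ε) → ∑ _∙_ f ≡ ε
  ∑-ε {zero} f f≡ε = f≡ε []
  ∑-ε {suc n} f f≡ε = trans (cong₂ _∙_ (∑-ε _ (f≡ε ∘ (false ∷_))) (∑-ε _ (f≡ε ∘ (true ∷_)))) (identityˡ ε)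

  ∑-distrib : ∀ (f g : Vec Bool n → A) → ∑ _∙_ (λ x → f x ∙ g x) ≡ ∑ _∙_ f ∙ ∑ _∙_ g
  ∑-distrib {zero} f g = refl
  ∑-distrib {suc n} f g = trans
    (cong₂ _∙_ (∑-distrib (f ∘ (false ∷_)) (g ∘ (false ∷_))) (∑-distrib (f ∘ (true ∷_)) (g ∘ (true ∷_))))
    (interchange _ _ _ _)

  ∑-comm : ∀ (f : Vec Bool m → Vec Bool n → A) →
           ∑ _∙_ (λ x → ∑ _∙_ (f x)) ≡ ∑ _∙_ (λ y → ∑ _∙_ (λ x → f x y))
  ∑-comm {zero} f = refl
  ∑-comm {suc m} f = trans (cong₂ _∙_ (∑-comm (f ∘ (false ∷_))) (∑-comm (f ∘ (true ∷_))))
    (sym (∑-distrib (λ y → ∑ _∙_ (λ x → f (false ∷ x) y)) (λ y → ∑ _∙_ (λ x → f (true ∷ x) y))))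

  ∑-translate : ∀ (f : Vec Bool n → A) y → ∑ _∙_ (λ x → f (x ⊕ y)) ≡ ∑ _∙_ f
  ∑-translate {zero} f [] = refl
  ∑-translate {suc n} f (b ∷ y) = trans (cong₂ _∙_ (∑-translate _ y) (∑-translate _ y)) (flip b)
    where
    flip : ∀ b → ∑ _∙_ (λ x → f ((false xor b) ∷ x)) ∙ ∑ _∙_ (λ x → f ((true xor b) ∷ x)) ≡
                 ∑ _∙_ (λ x → f (false ∷ x)) ∙ ∑ _∙_ (λ x → f (true ∷ x))
    flip false = refl
    flip true = comm _ _

  ∑-point : ∀ (f : Vec Bool n → A) → (∀ x → x ≢ 0ᵇ → f x ≡ ε) → ∑ _∙_ f ≡ f 0ᵇ
  ∑-point {zero} f _ = refl
  ∑-point {suc n} f vanish = trans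
    (cong₂ _∙_ (∑-point (f ∘ (false ∷_)) λ x x≢0 → vanish (false ∷ x) (x≢0 ∘ ∷-injectiveʳ))
               (∑-ε (f ∘ (true ∷_)) λ x → vanish (true ∷ x) λ ()))
    (identityʳ (f 0ᵇ))

·ᵥ-∑ : ∀ {d} k (f : Vec Bool d → Vec F5 n) → k ·ᵥ ∑ _+ᵥ_ f ≡ ∑ _+ᵥ_ (λ x → k ·ᵥ f x)
·ᵥ-∑ k = ∑-hom _+ᵥ_ _+ᵥ_ (k ·ᵥ_) (·ᵥ-distribˡ k)

∑-·ᵥ : ∀ {d} (c : Vec Bool d → F5) (v : Vec F5 n) → ∑ _+₅_ c ·ᵥ v ≡ ∑ _+ᵥ_ (λ x → c x ·ᵥ v)
∑-·ᵥ c v = ∑-hom _+₅_ _+ᵥ_ (_·ᵥ v) (λ a b → ·ᵥ-distribʳ a b v) c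

·ₘ-∑ : ∀ {d} (A : Vec (Vec F5 n) m) (f : Vec Bool d → Vec F5 n) → A ·ₘ ∑ _+ᵥ_ f ≡ ∑ _+ᵥ_ (λ x → A ·ₘ f x)
·ₘ-∑ A = ∑-hom _+ᵥ_ _+ᵥ_ (A ·ₘ_) (·ₘ-+ᵥ A)

-- Σₓ χ(x) counts 2⁴ = 16 ≡ 1 (mod 5) for the trivial character.
∑-char : ∀ (χ : Vec Bool 4) → ∑ _+₅_ (char χ) ≡ δ χ
∑-char = from-yes (∀ᵇ? {4} λ χ → ∑ _+₅_ (char χ) ≟ δ χ)

-- The subgroup V₄ × V₄ of A₅ × V₄

klein : Vec Bool 2 → Perm5
klein (false ∷ false ∷ []) = 0F ∷ 1F ∷ 2F ∷ 3F ∷ 4F ∷ []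
klein (true ∷ false ∷ []) = 1F ∷ 0F ∷ 3F ∷ 2F ∷ 4F ∷ []
klein (false ∷ true ∷ []) = 2F ∷ 3F ∷ 0F ∷ 1F ∷ 4F ∷ []
klein (true ∷ true ∷ []) = 3F ∷ 2F ∷ 1F ∷ 0F ∷ 4F ∷ []

klein-isPerm : ∀ x → IsPerm (klein x)
klein-isPerm = from-yes (∀ᵇ? {2} λ x → all? λ i → all? λ j →
  (lookup (klein x) i ≟ lookup (klein x) j) →-dec (i ≟ j))

klein-isEven : ∀ x → IsEven (klein x)
klein-isEven = from-yes (∀ᵇ? {2} λ x → inversions (klein x) % 2 ℕ.≟ 0)

embed : Vec Bool 4 → A5×V4
embed (a ∷ b ∷ c ∷ d ∷ []) = (klein ab , klein-isPerm ab , klein-isEven ab) , (c , d)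
  where
  ab : Vec Bool 2
  ab = a ∷ b ∷ []

_≟ₚ_ : (p q : Perm5 × V4) → Dec (p ≡ q)
_≟ₚ_ = Product.≡-dec (≡-dec _≟_) (Product.≡-dec Bool._≟_ Bool._≟_)

embed-hom : ∀ x y → ⌊ embed (x ⊕ y) ⌋ ≡ ⌊ embed x ⌋ · ⌊ embed y ⌋
embed-hom = from-yes (∀ᵇ? {4} λ x → ∀ᵇ? {4} λ y → ⌊ embed (x ⊕ y) ⌋ ≟ₚ (⌊ embed x ⌋ · ⌊ embed y ⌋))

embed-injective : ∀ x y → ⌊ embed x ⌋ ≡ ⌊ embed y ⌋ → x ≡ y
embed-injective = from-yes (∀ᵇ? {4} λ x → ∀ᵇ? {4} λ y → (⌊ embed x ⌋ ≟ₚ ⌊ embed y ⌋) →-dec (x ≟ᵇ y))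

-- Faithful representations of 𝔽₂⁴ on 𝔽₅³

IsFaithfulRepresentation : (Vec Bool 4 → M3) → Set
IsFaithfulRepresentation ρ = (∀ x y → ρ (x ⊕ y) ≡ ρ x ⊗ ρ y) × Injective _≡_ _≡_ ρ

module FaithfulRepresentation (ρ : Vec Bool 4 → M3) (faithful : IsFaithfulRepresentation ρ) where

  open Sum (+ᵥ-isCommutativeMonoid {3})

  ∑ᵥ : (Vec Bool n → Vec F5 3) → Vec F5 3
  ∑ᵥ = ∑ _+ᵥ_

  ρ-action : ∀ x y v → ρ x ·ₘ ρ y ·ₘ v ≡ ρ (x ⊕ y) ·ₘ v
  ρ-action x y v = trans (sym (⊗-·ₘ (ρ x) (ρ y) v)) (cong (_·ₘ v) (sym (proj₁ faithful x y)))

  -- The projection onto the χ-eigenspace; its usual normalising factor 1/16 is 1 in 𝔽₅.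
  π : Vec Bool 4 → Vec F5 3 → Vec F5 3
  π χ v = ∑ᵥ λ x → char χ x ·ᵥ ρ x ·ₘ v

  π-+ᵥ : ∀ χ v w → π χ (v +ᵥ w) ≡ π χ v +ᵥ π χ w
  π-+ᵥ χ v w = begin
    ∑ᵥ (λ x → char χ x ·ᵥ ρ x ·ₘ (v +ᵥ w))
      ≡⟨ ∑-cong _+ᵥ_ (λ x → trans (cong (char χ x ·ᵥ_) (·ₘ-+ᵥ (ρ x) v w))
                                   (·ᵥ-distribˡ (char χ x) (ρ x ·ₘ v) (ρ x ·ₘ w))) ⟩
    ∑ᵥ (λ x → char χ x ·ᵥ ρ x ·ₘ v +ᵥ char χ x ·ᵥ ρ x ·ₘ w)
      ≡⟨ ∑-distrib (λ x → char χ x ·ᵥ ρ x ·ₘ v) (λ x → char χ x ·ᵥ ρ x ·ₘ w) ⟩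
    π χ v +ᵥ π χ w ∎
    where open ≡-Reasoning

  π-·ᵥ : ∀ χ k v → π χ (k ·ᵥ v) ≡ k ·ᵥ π χ v
  π-·ᵥ χ k v = begin
    ∑ᵥ (λ x → char χ x ·ᵥ ρ x ·ₘ k ·ᵥ v)
      ≡⟨ ∑-cong _+ᵥ_ (λ x → trans (cong (char χ x ·ᵥ_) (·ₘ-·ᵥ (ρ x) k v)) (·ᵥ-comm (char χ x) k (ρ x ·ₘ v))) ⟩
    ∑ᵥ (λ x → k ·ᵥ char χ x ·ᵥ ρ x ·ₘ v)
      ≡⟨ ·ᵥ-∑ k (λ x → char χ x ·ᵥ ρ x ·ₘ v) ⟨
    k ·ᵥ π χ v ∎
    where open ≡-Reasoning

  π-zero : ∀ χ → π χ 0ᵥ ≡ 0ᵥ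
  π-zero χ = trans (π-·ᵥ χ 0F 0ᵥ) (·ᵥ-zeroˡ (π χ 0ᵥ))

  π-eigen : ∀ χ y v → ρ y ·ₘ π χ v ≡ char χ y ·ᵥ π χ v
  π-eigen χ y v = begin
    ρ y ·ₘ π χ v
      ≡⟨ ·ₘ-∑ (ρ y) (λ x → char χ x ·ᵥ ρ x ·ₘ v) ⟩
    ∑ᵥ (λ x → ρ y ·ₘ char χ x ·ᵥ ρ x ·ₘ v)
      ≡⟨ ∑-cong _+ᵥ_ (λ x → trans (·ₘ-·ᵥ (ρ y) (char χ x) (ρ x ·ₘ v))
                                   (cong (char χ x ·ᵥ_) (ρ-action y x v))) ⟩
    ∑ᵥ (λ x → char χ x ·ᵥ ρ (y ⊕ x) ·ₘ v)
      ≡⟨ ∑-translate (λ x → char χ x ·ᵥ ρ (y ⊕ x) ·ₘ v) y ⟨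
    ∑ᵥ (λ x → char χ (x ⊕ y) ·ᵥ ρ (y ⊕ (x ⊕ y)) ·ₘ v)
      ≡⟨ ∑-cong _+ᵥ_ translated ⟩
    ∑ᵥ (λ x → char χ y ·ᵥ char χ x ·ᵥ ρ x ·ₘ v)
      ≡⟨ ·ᵥ-∑ (char χ y) (λ x → char χ x ·ᵥ ρ x ·ₘ v) ⟨
    char χ y ·ᵥ π χ v ∎
    where
    open ≡-Reasoning
    translated : ∀ x → char χ (x ⊕ y) ·ᵥ ρ (y ⊕ (x ⊕ y)) ·ₘ v ≡ char χ y ·ᵥ char χ x ·ᵥ ρ x ·ₘ v
    translated x = begin
      char χ (x ⊕ y) ·ᵥ ρ (y ⊕ (x ⊕ y)) ·ₘ v
        ≡⟨ cong₂ (λ a z → a ·ᵥ ρ z ·ₘ v) (char-⊕ʳ χ x y) (⊕-cancel x y) ⟩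
      (char χ x *₅ char χ y) ·ᵥ ρ x ·ₘ v
        ≡⟨ cong (_·ᵥ ρ x ·ₘ v) (*₅-comm (char χ x) (char χ y)) ⟩
      (char χ y *₅ char χ x) ·ᵥ ρ x ·ₘ v
        ≡⟨ ·ᵥ-assoc (char χ y) (char χ x) _ ⟩
      char χ y ·ᵥ char χ x ·ᵥ ρ x ·ₘ v ∎

  IsEigenvector : Vec Bool 4 → Vec F5 3 → Set
  IsEigenvector χ v = ∀ x → ρ x ·ₘ v ≡ char χ x ·ᵥ v

  π-eigenvector : ∀ χ ψ v → IsEigenvector ψ v → π χ v ≡ δ (χ ⊕ ψ) ·ᵥ v
  π-eigenvector χ ψ v eigen = begin
    ∑ᵥ (λ x → char χ x ·ᵥ ρ x ·ₘ v)
      ≡⟨ ∑-cong _+ᵥ_ (λ x → begin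
           char χ x ·ᵥ ρ x ·ₘ v          ≡⟨ cong (char χ x ·ᵥ_) (eigen x) ⟩
           char χ x ·ᵥ char ψ x ·ᵥ v     ≡⟨ ·ᵥ-assoc (char χ x) (char ψ x) v ⟨
           (char χ x *₅ char ψ x) ·ᵥ v   ≡⟨ cong (_·ᵥ v) (char-⊕ˡ χ ψ x) ⟨
           char (χ ⊕ ψ) x ·ᵥ v ∎) ⟩
    ∑ᵥ (λ x → char (χ ⊕ ψ) x ·ᵥ v)
      ≡⟨ ∑-·ᵥ (char (χ ⊕ ψ)) v ⟨
    ∑ _+₅_ (char (χ ⊕ ψ)) ·ᵥ v
      ≡⟨ cong (_·ᵥ v) (∑-char (χ ⊕ ψ)) ⟩
    δ (χ ⊕ ψ) ·ᵥ v ∎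
    where open ≡-Reasoning

  ∑-π : ∀ v → ∑ᵥ (λ χ → π χ v) ≡ ρ 0ᵇ ·ₘ v
  ∑-π v = begin
    ∑ᵥ (λ χ → ∑ᵥ λ x → char χ x ·ᵥ ρ x ·ₘ v)
      ≡⟨ ∑-comm (λ χ x → char χ x ·ᵥ ρ x ·ₘ v) ⟩
    ∑ᵥ (λ x → ∑ᵥ λ χ → char χ x ·ᵥ ρ x ·ₘ v)
      ≡⟨ ∑-cong _+ᵥ_ (λ x → sym (∑-·ᵥ (λ χ → char χ x) (ρ x ·ₘ v))) ⟩
    ∑ᵥ (λ x → ∑ _+₅_ (λ χ → char χ x) ·ᵥ ρ x ·ₘ v)
      ≡⟨ ∑-cong _+ᵥ_ (λ x → cong (_·ᵥ ρ x ·ₘ v)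
           (trans (∑-cong _+₅_ (λ χ → cong sign (⊙-comm χ x))) (∑-char x))) ⟩
    ∑ᵥ (λ x → δ x ·ᵥ ρ x ·ₘ v)
      ≡⟨ ∑-point (λ x → δ x ·ᵥ ρ x ·ₘ v)
           (λ x x≢0 → trans (cong (_·ᵥ ρ x ·ₘ v) (δ-nonzero x x≢0)) (·ᵥ-zeroˡ (ρ x ·ₘ v))) ⟩
    δ (0ᵇ {4}) ·ᵥ ρ 0ᵇ ·ₘ v
      ≡⟨ trans (cong (_·ᵥ ρ 0ᵇ ·ₘ v) (δ-zero {4})) (·ᵥ-identityˡ (ρ 0ᵇ ·ₘ v)) ⟩
    ρ 0ᵇ ·ₘ v ∎
    where open ≡-Reasoning

  ρ-decomposition : ∀ y v → ρ y ·ₘ v ≡ ∑ᵥ (λ χ → char χ y ·ᵥ π χ v)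
  ρ-decomposition y v = begin
    ρ y ·ₘ v                          ≡⟨ cong (λ z → ρ z ·ₘ v) (⊕-identityʳ y) ⟨
    ρ (y ⊕ 0ᵇ) ·ₘ v                   ≡⟨ ρ-action y 0ᵇ v ⟨
    ρ y ·ₘ ρ 0ᵇ ·ₘ v                  ≡⟨ cong (ρ y ·ₘ_) (∑-π v) ⟨
    ρ y ·ₘ ∑ᵥ (λ χ → π χ v)           ≡⟨ ·ₘ-∑ (ρ y) (λ χ → π χ v) ⟩
    ∑ᵥ (λ χ → ρ y ·ₘ π χ v)           ≡⟨ ∑-cong _+ᵥ_ (λ χ → π-eigen χ y v) ⟩
    ∑ᵥ (λ χ → char χ y ·ᵥ π χ v)      ∎
    where open ≡-Reasoning

  record Weight : Set where
    field
      character : Vec Bool 4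
      vector    : Vec F5 3
      vector≢0  : vector ≢ 0ᵥ
      eigen     : IsEigenvector character vector

  open Weight

  undetected⇒ρ≡ρ0 : ∀ y → (∀ χ k → χ ⊙ y ≡ true → π χ (basis k) ≡ 0ᵥ) → ρ y ≡ ρ 0ᵇ
  undetected⇒ρ≡ρ0 y undetected = ·ₘ-basis-injective (ρ y) (ρ 0ᵇ) λ k → begin
    ρ y ·ₘ basis k
      ≡⟨ ρ-decomposition y (basis k) ⟩
    ∑ᵥ (λ χ → char χ y ·ᵥ π χ (basis k))
      ≡⟨ ∑-cong _+ᵥ_ (λ χ → char-·ᵥ-undetected χ y (π χ (basis k)) (undetected χ k)) ⟩
    ∑ᵥ (λ χ → π χ (basis k))
      ≡⟨ ∑-π (basis k) ⟩
    ρ 0ᵇ ·ₘ basis k ∎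
    where open ≡-Reasoning

  weight-detecting : ∀ y → y ≢ 0ᵇ → Σ Weight λ w → character w ⊙ y ≡ true
  weight-detecting y y≢0 = from-search
    (∃ᵇ? {4} (λ χ → (χ ⊙ y Bool.≟ true) ×-dec any? (λ k → ¬? (π χ (basis k) ≟ᵥ 0ᵥ))))
    where
    from-search : Dec (∃ λ χ → χ ⊙ y ≡ true × ∃ λ k → π χ (basis k) ≢ 0ᵥ) →
                  Σ Weight λ w → character w ⊙ y ≡ true
    from-search (yes (χ , χ⊙y , k , π≢0)) = weight , χ⊙y
      where
      weight : Weight
      weight = record
        { character = χ ; vector = π χ (basis k) ; vector≢0 = π≢0 ; eigen = λ x → π-eigen χ x (basis k) }
    from-search (no ∄) = ⊥-elim (y≢0 (proj₂ faithful (undetected⇒ρ≡ρ0 y λ χ k χ⊙y →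
      decidable-stable (π χ (basis k) ≟ᵥ 0ᵥ) λ π≢0 → ∄ (χ , χ⊙y , k , π≢0))))

  Distinct : Weight → Weight → Set
  Distinct w w′ = character w ≢ character w′

  π-own : ∀ w → π (character w) (vector w) ≡ vector w
  π-own w = begin
    π χ v                 ≡⟨ π-eigenvector χ χ v (eigen w) ⟩
    δ (χ ⊕ χ) ·ᵥ v        ≡⟨ cong (λ z → δ z ·ᵥ v) (⊕-self χ) ⟩
    δ (0ᵇ {4}) ·ᵥ v       ≡⟨ cong (_·ᵥ v) (δ-zero {4}) ⟩
    1F ·ᵥ v               ≡⟨ ·ᵥ-identityˡ v ⟩
    v                     ∎
    where
    open ≡-Reasoning
    χ : Vec Bool 4
    χ = character w
    v : Vec F5 3
    v = vector w

  π-other : ∀ w w′ → Distinct w w′ → π (character w) (vector w′) ≡ 0ᵥ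
  π-other w w′ w≢w′ = begin
    π χ v′              ≡⟨ π-eigenvector χ χ′ v′ (eigen w′) ⟩
    δ (χ ⊕ χ′) ·ᵥ v′    ≡⟨ cong (_·ᵥ v′) (δ-nonzero (χ ⊕ χ′) (w≢w′ ∘ ⊕≡0⇒≡ χ χ′)) ⟩
    0F ·ᵥ v′            ≡⟨ ·ᵥ-zeroˡ v′ ⟩
    0ᵥ                  ∎
    where
    open ≡-Reasoning
    χ : Vec Bool 4
    χ = character w
    χ′ : Vec Bool 4
    χ′ = character w′
    v′ : Vec F5 3
    v′ = vector w′

  lincomb : (ws : List Weight) → Vec F5 (length ws) → Vec F5 3
  lincomb [] [] = 0ᵥ
  lincomb (w ∷ ws) (c ∷ cs) = c ·ᵥ vector w +ᵥ lincomb ws cs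

  π-lincomb : ∀ w ws cs → All (Distinct w) ws → π (character w) (lincomb ws cs) ≡ 0ᵥ
  π-lincomb w [] [] [] = π-zero (character w)
  π-lincomb w (w′ ∷ ws) (c ∷ cs) (w≢w′ ∷ w-new) = begin
    π χ (c ·ᵥ vector w′ +ᵥ lincomb ws cs)          ≡⟨ π-+ᵥ χ (c ·ᵥ vector w′) (lincomb ws cs) ⟩
    π χ (c ·ᵥ vector w′) +ᵥ π χ (lincomb ws cs)    ≡⟨ cong₂ _+ᵥ_
                                                       (trans (π-·ᵥ χ c (vector w′)) (cong (c ·ᵥ_) (π-other w w′ w≢w′)))
                                                       (π-lincomb w ws cs w-new) ⟩
    c ·ᵥ 0ᵥ +ᵥ 0ᵥ                                   ≡⟨ trans (+ᵥ-identityʳ (c ·ᵥ 0ᵥ)) (·ᵥ-zeroʳ c) ⟩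
    0ᵥ                                              ∎
    where
    open ≡-Reasoning
    χ : Vec Bool 4
    χ = character w

  π-lincomb-head : ∀ w ws c cs → All (Distinct w) ws →
                   π (character w) (lincomb (w ∷ ws) (c ∷ cs)) ≡ c ·ᵥ vector w
  π-lincomb-head w ws c cs w-new = begin
    π χ (c ·ᵥ vector w +ᵥ lincomb ws cs)          ≡⟨ π-+ᵥ χ (c ·ᵥ vector w) (lincomb ws cs) ⟩
    π χ (c ·ᵥ vector w) +ᵥ π χ (lincomb ws cs)    ≡⟨ cong₂ _+ᵥ_
                                                      (trans (π-·ᵥ χ c (vector w)) (cong (c ·ᵥ_) (π-own w)))
                                                      (π-lincomb w ws cs w-new) ⟩
    c ·ᵥ vector w +ᵥ 0ᵥ                           ≡⟨ +ᵥ-identityʳ (c ·ᵥ vector w) ⟩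
    c ·ᵥ vector w                                 ∎
    where
    open ≡-Reasoning
    χ : Vec Bool 4
    χ = character w

  lincomb-injective : ∀ ws → AllPairs Distinct ws → Injective _≡_ _≡_ (lincomb ws)
  lincomb-injective [] [] {[]} {[]} _ = refl
  lincomb-injective (w ∷ ws) (w-new ∷ ws-distinct) {c ∷ cs} {d ∷ ds} eq =
    cong₂ _∷_ c≡d (lincomb-injective ws ws-distinct tails-equal)
    where
    c≡d : c ≡ d
    c≡d = ·ᵥ-cancelʳ c d (vector w) (vector≢0 w) (begin
      c ·ᵥ vector w                                 ≡⟨ π-lincomb-head w ws c cs w-new ⟨
      π (character w) (lincomb (w ∷ ws) (c ∷ cs))   ≡⟨ cong (π (character w)) eq ⟩
      π (character w) (lincomb (w ∷ ws) (d ∷ ds))   ≡⟨ π-lincomb-head w ws d ds w-new ⟩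
      d ·ᵥ vector w                                 ∎)
      where open ≡-Reasoning
    tails-equal : lincomb ws cs ≡ lincomb ws ds
    tails-equal = +ᵥ-cancelˡ (c ·ᵥ vector w) _ _
      (trans eq (cong (λ a → a ·ᵥ vector w +ᵥ lincomb ws ds) (sym c≡d)))

  new-weight : ∀ ws → length ws ≤ 3 → Σ Weight λ w → All (Distinct w) ws
  new-weight ws ws≤3 =
    let y , y≢0 , ws⊥y = common-kernel (List.map character ws)
                                       (subst (_≤ 3) (sym (length-map character ws)) ws≤3)
        w , w⊙y = weight-detecting y y≢0
    in w , All.map (λ {w′} → distinct w w′ y w⊙y) (All.map⁻ ws⊥y)
    where
    distinct : ∀ w w′ y → character w ⊙ y ≡ true → character w′ ⊙ y ≡ false → Distinct w w′
    distinct w w′ y w⊙y w′⊙y w≡w′ with trans (sym w⊙y) (trans (cong (_⊙ y) w≡w′) w′⊙y)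
    ... | ()

  distinct-weights : ∀ k → k ≤ 4 → Σ (List Weight) λ ws → length ws ≡ k × AllPairs Distinct ws
  distinct-weights zero _ = [] , refl , []
  distinct-weights (suc k) (s≤s k≤3) =
    let ws , length≡k , ws-distinct = distinct-weights k (m≤n⇒m≤1+n k≤3)
        w , w-new = new-weight ws (subst (_≤ 3) (sym length≡k) k≤3)
    in w ∷ ws , cong suc length≡k , w-new ∷ ws-distinct

  no-four-distinct-weights : ¬ (Σ (List Weight) λ ws → length ws ≡ 4 × AllPairs Distinct ws)
  no-four-distinct-weights (ws , length≡4 , ws-distinct) = from-no (5 ^ 4 ℕ.≤? 5 ^ 3)
    (subst (λ k → 5 ^ k ≤ 5 ^ 3) length≡4 (vec-injection⇒^≤ (lincomb-injective ws ws-distinct)))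

no-faithful-representation : ∀ ρ → ¬ IsFaithfulRepresentation ρ
no-faithful-representation ρ faithful = no-four-distinct-weights (distinct-weights 4 ≤-refl)
  where open FaithfulRepresentation ρ faithful

lemma3p18 : ¬ (Σ (A5×V4 → GL3F5) IsEmbedding)
lemma3p18 (φ , φ-hom , φ-injective) = no-faithful-representation ρ (ρ-hom , ρ-injective)
  where
  ρ : Vec Bool 4 → M3
  ρ x = proj₁ (φ (embed x))

  ρ-hom : ∀ x y → ρ (x ⊕ y) ≡ ρ x ⊗ ρ y
  ρ-hom x y = φ-hom (embed x) (embed y) (embed (x ⊕ y)) (embed-hom x y)

  ρ-injective : Injective _≡_ _≡_ ρ
  ρ-injective {x} {y} eq = embed-injective x y (φ-injective (embed x) (embed y) eq)
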